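{- Let $\mathcal{G}=(V,E,\mathcal{E})$ be an extended graph and let $v\in V$ satisfy $\deg(v)=2$ with $N(v)=\{u,w\}$, $\deg(u)=\deg(w)=2$, and $\deg_2(v)=0$. Then $v$ is contained in some maximum 2-packing set of $\mathcal{G}$. Consequently, with $\mathcal{G}'=\mathcal{G}[V\setminus N^2[v]]$, we have $\beta(\mathcal{G})=\beta(\mathcal{G}')+1$.
   Context: Let $H=(V_H,E_H)$ be a finite simple undirected graph and let $\mathcal{E}_H$ be the set of unordered pairs $\{x,y\}$ of distinct vertices with $\{x,y\}\notin E_H$ that have a common neighbor in $H$. An extended graph $\mathcal{G}=(V,E,\mathcal{E})$ is obtained from such an $H$ by choosing $V\subseteq V_H$ and letting $E$ (resp. $\mathcal{E}$) be the pairs of $E_H$ (resp. $\mathcal{E}_H$) with both endpoints in $V$. For $U\subseteq V$, $\mathcal{G}[U]$ denotes the extended graph on $U$ keeping exactly the pairs of $E$ and of $\mathcal{E}$ with both endpoints in $U$. For $v\in V$: $N(v)=\{x:\{x,v\}\in E\}$, $N[v]=N(v)\cup\{v\}$, $\deg(v)=|N(v)|$, $N^2(v)=\{x:\{x,v\}\in\mathcal{E}\}$, $N^2[v]=N^2(v)\cup N[v]$, $\deg_2(v)=|N^2(v)|$. A 2-packing set of $\mathcal{G}$ is a set $S\subseteq V$ such that no two distinct vertices of $S$ form a pair in $E\cup\mathcal{E}$; a maximum 2-packing set is one of maximum cardinality, and $\beta(\mathcal{G})$ is this maximum cardinality. -}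

module Defs where

open import Data.Nat using (ℕ; zero; suc; _≤_)
open import Data.Bool using (Bool; true; false; _∧_; not; _∨_)
open import Data.Fin using (Fin; _≟_)
open import Data.Fin.Subset using (Subset; _∈_; _⊆_; ∣_∣; _∪_; _∩_; ∁; ⁅_⁆)
open import Data.List using (List; foldr; map)
open import Data.Bool.ListAction using (or)
open import Data.Vec using (tabulate; lookup)
open import Data.Product using (Σ; _×_; ∃)
open import Relation.Nullary using (¬_)
open import Relation.Nullary.Decidable using (⌊_⌋)
open import Relation.Binary.PropositionalEquality using (_≡_)
import Data.List as L

record SimpleGraph (n : ℕ) : Set where
  field
    adj    : Fin n → Fin n → Bool
    sym    : ∀ x y → adj x y ≡ adj y x
    irrefl : ∀ x → adj x x ≡ false
open SimpleGraph public

commonNeighbour : ∀ {n} → SimpleGraph n → Fin n → Fin n → Bool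
commonNeighbour {n} H x y = or (map (λ z → adj H x z ∧ adj H z y) (L.allFin n))

isEdgeH : ∀ {n} → SimpleGraph n → Fin n → Fin n → Bool
isEdgeH H x y = adj H x y

isExtEdgeH : ∀ {n} → SimpleGraph n → Fin n → Fin n → Bool
isExtEdgeH H x y = not ⌊ x ≟ y ⌋ ∧ not (adj H x y) ∧ commonNeighbour H x y

-- An extended graph: a host graph H together with a vertex subset V ⊆ V_H.
-- E and 𝓔 are the pairs of E_H and 𝓔_H with both endpoints in V.
record ExtGraph (n : ℕ) : Set where
  field
    host : SimpleGraph n
    V    : Subset n
open ExtGraph public

inV : ∀ {n} → ExtGraph n → Fin n → Bool
inV G x = lookup (V G) x

isE : ∀ {n} → ExtGraph n → Fin n → Fin n → Bool
isE G x y = inV G x ∧ inV G y ∧ isEdgeH (host G) x y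

isℰ : ∀ {n} → ExtGraph n → Fin n → Fin n → Bool
isℰ G x y = inV G x ∧ inV G y ∧ isExtEdgeH (host G) x y

-- G[U] : keep exactly the pairs of E and 𝓔 with both endpoints in U (U ⊆ V)
induced : ∀ {n} → ExtGraph n → Subset n → ExtGraph n
induced G U = record { host = host G ; V = U }

N : ∀ {n} → ExtGraph n → Fin n → Subset n
N G v = tabulate (λ x → isE G x v)

N[_] : ∀ {n} → ExtGraph n → Fin n → Subset n
N[ G ] v = N G v ∪ ⁅ v ⁆

deg : ∀ {n} → ExtGraph n → Fin n → ℕ
deg G v = ∣ N G v ∣

N² : ∀ {n} → ExtGraph n → Fin n → Subset n
N² G v = tabulate (λ x → isℰ G x v)

N²[_] : ∀ {n} → ExtGraph n → Fin n → Subset n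
N²[ G ] v = N² G v ∪ N[ G ] v

deg₂ : ∀ {n} → ExtGraph n → Fin n → ℕ
deg₂ G v = ∣ N² G v ∣

_∖_ : ∀ {n} → Subset n → Subset n → Subset n
A ∖ B = A ∩ ∁ B

IsTwoPacking : ∀ {n} → ExtGraph n → Subset n → Set
IsTwoPacking G S =
  S ⊆ V G ×
  (∀ x y → x ∈ S → y ∈ S → ¬ (x ≡ y) → (isE G x y ≡ false × isℰ G x y ≡ false))

IsMaxTwoPacking : ∀ {n} → ExtGraph n → Subset n → Set
IsMaxTwoPacking G S = IsTwoPacking G S × (∀ T → IsTwoPacking G T → ∣ T ∣ ≤ ∣ S ∣)

IsBeta : ∀ {n} → ExtGraph n → ℕ → Set
IsBeta G k = Σ _ (λ S → IsMaxTwoPacking G S × ∣ S ∣ ≡ k)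

{-# OPTIONS --safe #-}
module Submission where

-- Call two distinct vertices conflicting when they form a pair of E ∪ 𝓔. Every two distinct
-- vertices of N²[v] ∩ V = {u, v, w} conflict (u and w have the common neighbour v), so a
-- 2-packing of G meets N²[v] in at most one vertex; deleting it leaves a 2-packing of
-- G′ = G[V ∖ N²[v]]. Conversely no vertex of G′ conflicts with v, so adding v to a 2-packing
-- of G′ gives one of G. Hence a maximum 2-packing of G′ plus v is a maximum 2-packing of G
-- and β(G) = β(G′) + 1. This works for every vertex v whose N²[v] is a clique of the
-- conflict relation.

open import Defs hiding (sym)
open import Data.Bool using (Bool; true; false; _∧_; not)
open import Data.Bool.ListAction using (or)
open import Data.Bool.Properties using (∧-comm; ¬-not; not-¬; T-≡)
import Data.Bool.Properties as Bool
open import Data.Empty using (⊥-elim)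
open import Data.Fin using (Fin; zero; suc; _≟_)
open import Data.Fin.Properties using (all?; any?)
open import Data.Fin.Subset
  using (Subset; inside; outside; _∈_; _∉_; _⊆_; _∪_; _─_; _-_; ⁅_⁆; ⊥; ∣_∣)
open import Data.Fin.Subset.Properties
  using (_∈?_; _⊆?_; anySubset?; ∉⊥; ∣p∣≤n; x∈⁅x⁆; x∈⁅y⁆⇒x≡y; x∉⁅y⁆⇒x≢y; x∈p∪q⁺; x∈p∪q⁻;
         x∈p∩q⁺; x∈p∩q⁻; p∩q⊆p; x∈∁p⇒x∉p; x∉p⇒x∈∁p; p─q⊆p; p─⊥≡p; ∪-identityʳ;
         x∈p⇒∣p-x∣<∣p∣)
open import Data.List using (allFin)
open import Data.List.Properties using (map-cong)
open import Data.List.Membership.Propositional using (lose)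
open import Data.List.Membership.Propositional.Properties using (∈-allFin)
open import Data.List.Relation.Unary.Any.Properties using (any⁺)
open import Data.Nat using (ℕ; zero; suc; _+_; _≤_; _<_; _≤?_; s≤s)
open import Data.Nat.Properties
  using (≤-refl; ≤-trans; ≤-antisym; n≤1+n; m≤m+n; +-suc; +-monoʳ-≤; ≤⇒≯; ≮⇒≥; n≮0;
         suc-injective; module ≤-Reasoning)
open import Data.Product using (Σ; Σ-syntax; _×_; _,_; proj₁; proj₂)
import Data.Product as Product
open import Data.Sum using (_⊎_; inj₁; inj₂; [_,_]; map₂)
open import Data.Vec using (_∷_; here; there; tabulate)
open import Data.Vec.Properties using (lookup∘tabulate; []=⇒lookup; lookup⇒[]=)
open import Function using (_∘_; Equivalence)
open import Relation.Nullary using (¬_; yes; no; ¬?)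
open import Relation.Nullary.Decidable using (⌊_⌋; _×-dec_; _→-dec_)
open import Relation.Unary using (Pred; Decidable)
open import Relation.Binary.PropositionalEquality
  using (_≡_; _≢_; refl; sym; trans; cong; cong₂; subst; module ≡-Reasoning)

∣s∷p∣≤1+∣p∣ : ∀ {n} s (p : Subset n) → ∣ s ∷ p ∣ ≤ suc ∣ p ∣
∣s∷p∣≤1+∣p∣ inside  p = ≤-refl
∣s∷p∣≤1+∣p∣ outside p = n≤1+n ∣ p ∣

∣p∣≤1+∣p-x∣ : ∀ {n} (p : Subset n) x → ∣ p ∣ ≤ suc ∣ p - x ∣
∣p∣≤1+∣p-x∣ (s ∷ p)       zero    =
  subst (λ q → ∣ s ∷ p ∣ ≤ suc ∣ q ∣) (sym (p─⊥≡p p)) (∣s∷p∣≤1+∣p∣ s p)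
∣p∣≤1+∣p-x∣ (inside  ∷ p) (suc x) = s≤s (∣p∣≤1+∣p-x∣ p x)
∣p∣≤1+∣p-x∣ (outside ∷ p) (suc x) = ∣p∣≤1+∣p-x∣ p x

x∈p─q⇒x∉q : ∀ {n} {x : Fin n} {p q : Subset n} → x ∈ p ─ q → x ∉ q
x∈p─q⇒x∉q {p = _ ∷ _} {inside  ∷ _} ()                 here
x∈p─q⇒x∉q {p = _ ∷ _} {_       ∷ _} (there x∈p─q) (there x∈q) =
  x∈p─q⇒x∉q x∈p─q x∈q

x∉p⇒∣p∪⁅x⁆∣≡1+∣p∣ : ∀ {n} {p : Subset n} {x} → x ∉ p → ∣ p ∪ ⁅ x ⁆ ∣ ≡ suc ∣ p ∣
x∉p⇒∣p∪⁅x⁆∣≡1+∣p∣ {p = inside  ∷ p} {zero}  x∉p = ⊥-elim (x∉p here)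
x∉p⇒∣p∪⁅x⁆∣≡1+∣p∣ {p = outside ∷ p} {zero}  _   = cong (suc ∘ ∣_∣) (∪-identityʳ p)
x∉p⇒∣p∪⁅x⁆∣≡1+∣p∣ {p = inside  ∷ p} {suc x} x∉p = cong suc (x∉p⇒∣p∪⁅x⁆∣≡1+∣p∣ (x∉p ∘ there))
x∉p⇒∣p∪⁅x⁆∣≡1+∣p∣ {p = outside ∷ p} {suc x} x∉p = x∉p⇒∣p∪⁅x⁆∣≡1+∣p∣ (x∉p ∘ there)

∣p∣≡0⇒x∉p : ∀ {n} {p : Subset n} {x} → ∣ p ∣ ≡ 0 → x ∉ p
∣p∣≡0⇒x∉p {p = p} {x} ∣p∣≡0 x∈p = n≮0 (subst (∣ p - x ∣ <_) ∣p∣≡0 (x∈p⇒∣p-x∣<∣p∣ x∈p))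

∈-tabulate⁺ : ∀ {n} {f : Fin n → Bool} {x} → f x ≡ true → x ∈ tabulate f
∈-tabulate⁺ {f = f} {x} fx≡true = lookup⇒[]= x (tabulate f) (trans (lookup∘tabulate f x) fx≡true)

∈-tabulate⁻ : ∀ {n} {f : Fin n → Bool} {x} → x ∈ tabulate f → f x ≡ true
∈-tabulate⁻ {f = f} {x} x∈ = trans (sym (lookup∘tabulate f x)) ([]=⇒lookup x∈)

maximum-exists : ∀ {n ℓ} {P : Pred (Subset n) ℓ} → Decidable P → ∀ {p} → P p →
                 Σ[ S ∈ Subset n ] P S × (∀ T → P T → ∣ T ∣ ≤ ∣ S ∣)
maximum-exists {n} {P = P} P? {p} Pp = grow n p Pp (m≤m+n n ∣ p ∣)
  where
  -- Each step strictly increases ∣ S ∣ ≤ n, so n steps of fuel suffice.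
  grow : ∀ fuel S → P S → n ≤ fuel + ∣ S ∣ → Σ[ M ∈ Subset n ] P M × (∀ T → P T → ∣ T ∣ ≤ ∣ M ∣)
  grow fuel S PS n≤fuel+∣S∣ with anySubset? (λ T → P? T ×-dec (suc ∣ S ∣ ≤? ∣ T ∣))
  ... | no ∄larger = S , PS , λ T PT → ≮⇒≥ (λ ∣S∣<∣T∣ → ∄larger (T , PT , ∣S∣<∣T∣))
  grow zero S _ n≤∣S∣ | yes (T , _ , ∣S∣<∣T∣) =
    ⊥-elim (≤⇒≯ (≤-trans (∣p∣≤n T) n≤∣S∣) ∣S∣<∣T∣)
  grow (suc fuel) S _ n≤fuel+∣S∣ | yes (T , PT , ∣S∣<∣T∣) = grow fuel T PT (begin
    n                  ≤⟨ n≤fuel+∣S∣ ⟩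
    suc (fuel + ∣ S ∣) ≡⟨ +-suc fuel ∣ S ∣ ⟨
    fuel + suc ∣ S ∣   ≤⟨ +-monoʳ-≤ fuel ∣S∣<∣T∣ ⟩
    fuel + ∣ T ∣       ∎)
    where open ≤-Reasoning

∧-swap : ∀ a b {c d} → c ≡ d → a ∧ b ∧ c ≡ b ∧ a ∧ d
∧-swap true  true  c≡d = c≡d
∧-swap true  false _   = refl
∧-swap false true  _   = refl
∧-swap false false _   = refl

∧-true₃ : ∀ {a b c} → a ∧ b ∧ c ≡ true → a ≡ true × b ≡ true × c ≡ true
∧-true₃ {true} {true} c≡true = refl , refl , c≡true

∧-trueˡ₂ : ∀ {a b c} → a ≡ true → b ≡ true → a ∧ b ∧ c ≡ c
∧-trueˡ₂ refl refl = refl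

⌊≟⌋-sym : ∀ {n} (x y : Fin n) → ⌊ x ≟ y ⌋ ≡ ⌊ y ≟ x ⌋
⌊≟⌋-sym x y with x ≟ y | y ≟ x
... | yes _   | yes _   = refl
... | no _    | no _    = refl
... | yes x≡y | no y≢x  = ⊥-elim (y≢x (sym x≡y))
... | no x≢y  | yes y≡x = ⊥-elim (x≢y (sym y≡x))

module _ {n} (H : SimpleGraph n) where

  commonNeighbour-sym : ∀ x y → commonNeighbour H x y ≡ commonNeighbour H y x
  commonNeighbour-sym x y = cong or (map-cong swap (allFin n))
    where
    swap : ∀ z → adj H x z ∧ adj H z y ≡ adj H y z ∧ adj H z x
    swap z = trans (∧-comm (adj H x z) (adj H z y))
                   (cong₂ _∧_ (SimpleGraph.sym H z y) (SimpleGraph.sym H x z))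

  commonNeighbour-intro : ∀ {x y} z → adj H x z ≡ true → adj H z y ≡ true →
                          commonNeighbour H x y ≡ true
  commonNeighbour-intro z x~z z~y = Equivalence.to T-≡ (any⁺ _ (lose (∈-allFin z)
    (Equivalence.from T-≡ (cong₂ _∧_ x~z z~y))))

  isExtEdgeH-sym : ∀ x y → isExtEdgeH H x y ≡ isExtEdgeH H y x
  isExtEdgeH-sym x y = cong₂ _∧_ (cong not (⌊≟⌋-sym x y))
    (cong₂ _∧_ (cong not (SimpleGraph.sym H x y)) (commonNeighbour-sym x y))

Conflicting : ∀ {n} → ExtGraph n → Fin n → Fin n → Set
Conflicting G x y = isE G x y ≡ true ⊎ isℰ G x y ≡ true

module _ {n} (G : ExtGraph n) where

  isE-sym : ∀ x y → isE G x y ≡ isE G y x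
  isE-sym x y = ∧-swap (inV G x) (inV G y) (SimpleGraph.sym (host G) x y)

  isℰ-sym : ∀ x y → isℰ G x y ≡ isℰ G y x
  isℰ-sym x y = ∧-swap (inV G x) (inV G y) (isExtEdgeH-sym (host G) x y)

  conflicting-sym : ∀ {x y} → Conflicting G x y → Conflicting G y x
  conflicting-sym {x} {y} (inj₁ e) = inj₁ (trans (isE-sym y x) e)
  conflicting-sym {x} {y} (inj₂ e) = inj₂ (trans (isℰ-sym y x) e)

  isE-endpoints : ∀ {x y} → isE G x y ≡ true →
                  inV G x ≡ true × inV G y ≡ true × adj (host G) x y ≡ true
  isE-endpoints = ∧-true₃

  commonNeighbour⇒conflicting : ∀ {x y} z → inV G x ≡ true → inV G y ≡ true → x ≢ y →
                                adj (host G) x z ≡ true → adj (host G) z y ≡ true →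
                                Conflicting G x y
  commonNeighbour⇒conflicting {x} {y} z x∈V y∈V x≢y x~z z~y with adj (host G) x y | x ≟ y
  ... | _     | yes x≡y = ⊥-elim (x≢y x≡y)
  ... | true  | no _    = inj₁ (∧-trueˡ₂ x∈V y∈V)
  ... | false | no _    = inj₂ (trans (∧-trueˡ₂ x∈V y∈V) (commonNeighbour-intro (host G) z x~z z~y))

  isE-induced : ∀ {U x y} → x ∈ U → y ∈ U → x ∈ V G → y ∈ V G →
                isE (induced G U) x y ≡ isE G x y
  isE-induced x∈U y∈U x∈V y∈V = trans (∧-trueˡ₂ ([]=⇒lookup x∈U) ([]=⇒lookup y∈U))
    (sym (∧-trueˡ₂ ([]=⇒lookup x∈V) ([]=⇒lookup y∈V)))

  isℰ-induced : ∀ {U x y} → x ∈ U → y ∈ U → x ∈ V G → y ∈ V G →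
                isℰ (induced G U) x y ≡ isℰ G x y
  isℰ-induced x∈U y∈U x∈V y∈V = trans (∧-trueˡ₂ ([]=⇒lookup x∈U) ([]=⇒lookup y∈U))
    (sym (∧-trueˡ₂ ([]=⇒lookup x∈V) ([]=⇒lookup y∈V)))

  twoPacking-conflictFree : ∀ {S x y} → IsTwoPacking G S → x ∈ S → y ∈ S → x ≢ y →
                            ¬ Conflicting G x y
  twoPacking-conflictFree (_ , separated) x∈S y∈S x≢y with separated _ _ x∈S y∈S x≢y
  ... | e≡false , ℰ≡false = [ not-¬ e≡false , not-¬ ℰ≡false ]

  twoPacking-intro : ∀ {S} → S ⊆ V G →
                     (∀ {x y} → x ∈ S → y ∈ S → x ≢ y → ¬ Conflicting G x y) →
                     IsTwoPacking G S
  twoPacking-intro S⊆V conflictFree = S⊆V , λ x y x∈S y∈S x≢y →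
    let ¬conflict = conflictFree x∈S y∈S x≢y in ¬-not (¬conflict ∘ inj₁) , ¬-not (¬conflict ∘ inj₂)

  twoPacking? : Decidable (IsTwoPacking G)
  twoPacking? S = S ⊆? V G ×-dec all? λ x → all? λ y →
    x ∈? S →-dec (y ∈? S →-dec (¬? (x ≟ y) →-dec
      ((isE G x y Bool.≟ false) ×-dec (isℰ G x y Bool.≟ false))))

  maxTwoPacking : Σ (Subset n) (IsMaxTwoPacking G)
  maxTwoPacking = maximum-exists twoPacking? {⊥} ((⊥-elim ∘ ∉⊥) , λ _ _ x∈⊥ → ⊥-elim (∉⊥ x∈⊥))

  maxTwoPacking-size : ∀ {S T} → IsMaxTwoPacking G S → IsMaxTwoPacking G T → ∣ S ∣ ≡ ∣ T ∣
  maxTwoPacking-size (S-pack , S-max) (T-pack , T-max) = ≤-antisym (T-max _ S-pack) (S-max _ T-pack)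

  twoPacking-⊆ : ∀ {S T} → T ⊆ S → IsTwoPacking G S → IsTwoPacking G T
  twoPacking-⊆ T⊆S (S⊆V , separated) =
    S⊆V ∘ T⊆S , λ x y x∈T y∈T → separated x y (T⊆S x∈T) (T⊆S y∈T)

  twoPacking-∪⁅⁆ : ∀ {S v} → IsTwoPacking G S → v ∈ V G →
                   (∀ {y} → y ∈ S → ¬ Conflicting G y v) → IsTwoPacking G (S ∪ ⁅ v ⁆)
  twoPacking-∪⁅⁆ {S} {v} S-pack v∈V apart = twoPacking-intro S∪v⊆V conflictFree
    where
    ∈S∪⁅v⁆⁻ : ∀ {x} → x ∈ S ∪ ⁅ v ⁆ → x ∈ S ⊎ x ≡ v
    ∈S∪⁅v⁆⁻ x∈ = map₂ (x∈⁅y⁆⇒x≡y v) (x∈p∪q⁻ S ⁅ v ⁆ x∈)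

    S∪v⊆V : S ∪ ⁅ v ⁆ ⊆ V G
    S∪v⊆V x∈ with ∈S∪⁅v⁆⁻ x∈
    ... | inj₁ x∈S  = proj₁ S-pack x∈S
    ... | inj₂ refl = v∈V

    conflictFree : ∀ {x y} → x ∈ S ∪ ⁅ v ⁆ → y ∈ S ∪ ⁅ v ⁆ → x ≢ y → ¬ Conflicting G x y
    conflictFree x∈ y∈ x≢y with ∈S∪⁅v⁆⁻ x∈ | ∈S∪⁅v⁆⁻ y∈
    ... | inj₁ x∈S  | inj₁ y∈S  = twoPacking-conflictFree S-pack x∈S y∈S x≢y
    ... | inj₁ x∈S  | inj₂ refl = apart x∈S
    ... | inj₂ refl | inj₁ y∈S  = apart y∈S ∘ conflicting-sym
    ... | inj₂ refl | inj₂ refl = ⊥-elim (x≢y refl)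

  twoPacking-induced⁺ : ∀ {U S} → U ⊆ V G → IsTwoPacking (induced G U) S → IsTwoPacking G S
  twoPacking-induced⁺ U⊆V (S⊆U , separated) = U⊆V ∘ S⊆U , λ x y x∈S y∈S x≢y →
    let x∈U = S⊆U x∈S ; y∈U = S⊆U y∈S
        (e≡false , ℰ≡false) = separated x y x∈S y∈S x≢y
    in trans (sym (isE-induced x∈U y∈U (U⊆V x∈U) (U⊆V y∈U))) e≡false
     , trans (sym (isℰ-induced x∈U y∈U (U⊆V x∈U) (U⊆V y∈U))) ℰ≡false

  twoPacking-induced⁻ : ∀ {U S} → S ⊆ U → IsTwoPacking G S → IsTwoPacking (induced G U) S
  twoPacking-induced⁻ S⊆U (S⊆V , separated) = S⊆U , λ x y x∈S y∈S x≢y →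
    let (e≡false , ℰ≡false) = separated x y x∈S y∈S x≢y
    in trans (isE-induced (S⊆U x∈S) (S⊆U y∈S) (S⊆V x∈S) (S⊆V y∈S)) e≡false
     , trans (isℰ-induced (S⊆U x∈S) (S⊆U y∈S) (S⊆V x∈S) (S⊆V y∈S)) ℰ≡false

clique₃ : ∀ {a ℓ} {A : Set a} {_~_ : A → A → Set ℓ} → (∀ {x y} → x ~ y → y ~ x) →
          ∀ {u v w} → u ~ v → w ~ v → (u ≢ w → u ~ w) →
          ∀ {x y} → x ≡ u ⊎ x ≡ v ⊎ x ≡ w → y ≡ u ⊎ y ≡ v ⊎ y ≡ w → x ≢ y → x ~ y
clique₃ _     _   _   _   (inj₁ refl)        (inj₁ refl)        x≢y = ⊥-elim (x≢y refl)
clique₃ _     u~v _   _   (inj₁ refl)        (inj₂ (inj₁ refl)) _   = u~v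
clique₃ _     _   _   u~w (inj₁ refl)        (inj₂ (inj₂ refl)) x≢y = u~w x≢y
clique₃ ~-sym u~v _   _   (inj₂ (inj₁ refl)) (inj₁ refl)        _   = ~-sym u~v
clique₃ _     _   _   _   (inj₂ (inj₁ refl)) (inj₂ (inj₁ refl)) x≢y = ⊥-elim (x≢y refl)
clique₃ ~-sym _   w~v _   (inj₂ (inj₁ refl)) (inj₂ (inj₂ refl)) _   = ~-sym w~v
clique₃ ~-sym _   _   u~w (inj₂ (inj₂ refl)) (inj₁ refl)        x≢y = ~-sym (u~w (x≢y ∘ sym))
clique₃ _     _   w~v _   (inj₂ (inj₂ refl)) (inj₂ (inj₁ refl)) _   = w~v
clique₃ _     _   _   _   (inj₂ (inj₂ refl)) (inj₂ (inj₂ refl)) x≢y = ⊥-elim (x≢y refl)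

module SimplicialReduction {n} (G : ExtGraph n) (v : Fin n) (v∈V : v ∈ V G)
  (N²[v]-clique : ∀ {x y} → x ∈ N²[ G ] v → y ∈ N²[ G ] v → x ≢ y → Conflicting G x y)
  where

  G′ : ExtGraph n
  G′ = induced G (V G ∖ N²[ G ] v)

  v∈N²[v] : v ∈ N²[ G ] v
  v∈N²[v] = x∈p∪q⁺ (inj₂ (x∈p∪q⁺ (inj₂ (x∈⁅x⁆ v))))

  ∉N²[v]⇒¬conflicting : ∀ {y} → y ∉ N²[ G ] v → ¬ Conflicting G y v
  ∉N²[v]⇒¬conflicting y∉ (inj₁ y~v) = y∉ (x∈p∪q⁺ (inj₂ (x∈p∪q⁺ (inj₁ (∈-tabulate⁺ y~v)))))
  ∉N²[v]⇒¬conflicting y∉ (inj₂ y~v) = y∉ (x∈p∪q⁺ (inj₁ (∈-tabulate⁺ y~v)))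

  ∈V′⁻ : ∀ {y} → y ∈ V G′ → y ∈ V G × y ∉ N²[ G ] v
  ∈V′⁻ y∈ = Product.map₂ x∈∁p⇒x∉p (x∈p∩q⁻ (V G) _ y∈)

  extend : ∀ {T} → IsTwoPacking G′ T → IsTwoPacking G (T ∪ ⁅ v ⁆)
  extend T-pack = twoPacking-∪⁅⁆ G (twoPacking-induced⁺ G (p∩q⊆p (V G) _) T-pack) v∈V
    (∉N²[v]⇒¬conflicting ∘ proj₂ ∘ ∈V′⁻ ∘ proj₁ T-pack)

  extend-size : ∀ {T} → IsTwoPacking G′ T → ∣ T ∪ ⁅ v ⁆ ∣ ≡ suc ∣ T ∣
  extend-size T-pack = x∉p⇒∣p∪⁅x⁆∣≡1+∣p∣ (λ v∈T → proj₂ (∈V′⁻ (proj₁ T-pack v∈T)) v∈N²[v])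

  twoPacking-avoidsN²[v] : ∀ {R} → IsTwoPacking G R →
                           Σ[ x ∈ Fin n ] (∀ {y} → y ∈ R - x → y ∉ N²[ G ] v)
  twoPacking-avoidsN²[v] {R} R-pack with any? (λ x → x ∈? R ×-dec x ∈? N²[ G ] v)
  ... | yes (x , x∈R , x∈N²) = x , λ y∈R-x y∈N² →
    let y∈R = p─q⊆p R _ y∈R-x
        y≢x = x∉⁅y⁆⇒x≢y (x∈p─q⇒x∉q y∈R-x)
    in twoPacking-conflictFree G R-pack y∈R x∈R y≢x
         (N²[v]-clique y∈N² x∈N² y≢x)
  ... | no ∄x = v , λ y∈R-v y∈N² → ∄x (_ , p─q⊆p R _ y∈R-v , y∈N²)

  shrink : ∀ {R} → IsTwoPacking G R → Σ[ R₀ ∈ Subset n ] IsTwoPacking G′ R₀ × ∣ R ∣ ≤ suc ∣ R₀ ∣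
  shrink {R} R-pack with twoPacking-avoidsN²[v] R-pack
  ... | x , avoids = R - x , twoPacking-induced⁻ G R-x⊆V′ R-x-pack , ∣p∣≤1+∣p-x∣ R x
    where
    R-x-pack : IsTwoPacking G (R - x)
    R-x-pack = twoPacking-⊆ G (p─q⊆p R _) R-pack

    R-x⊆V′ : R - x ⊆ V G′
    R-x⊆V′ y∈ = x∈p∩q⁺ (proj₁ R-x-pack y∈ , x∉p⇒x∈∁p (avoids y∈))

  extend-maximum : ∀ {T} → IsMaxTwoPacking G′ T → IsMaxTwoPacking G (T ∪ ⁅ v ⁆)
  extend-maximum {T} (T-pack , T-max) = extend T-pack , λ R R-pack →
    let (R₀ , R₀-pack , ∣R∣≤1+∣R₀∣) = shrink R-pack in begin
      ∣ R ∣             ≤⟨ ∣R∣≤1+∣R₀∣ ⟩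
      suc ∣ R₀ ∣        ≤⟨ s≤s (T-max R₀ R₀-pack) ⟩
      suc ∣ T ∣         ≡⟨ extend-size T-pack ⟨
      ∣ T ∪ ⁅ v ⁆ ∣     ∎
    where open ≤-Reasoning

  v∈maxTwoPacking : Σ[ S ∈ Subset n ] IsMaxTwoPacking G S × v ∈ S
  v∈maxTwoPacking with maxTwoPacking G′
  ... | T , T-max = T ∪ ⁅ v ⁆ , extend-maximum T-max , x∈p∪q⁺ (inj₂ (x∈⁅x⁆ v))

  β-suc : ∀ k → IsBeta G′ k → IsBeta G (suc k)
  β-suc k (T , T-max , ∣T∣≡k) =
    T ∪ ⁅ v ⁆ , extend-maximum T-max , trans (extend-size (proj₁ T-max)) (cong suc ∣T∣≡k)

  β-pred : ∀ k → IsBeta G (suc k) → IsBeta G′ k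
  β-pred k (S , S-max , ∣S∣≡1+k) with maxTwoPacking G′
  ... | T , T-max = T , T-max , suc-injective (begin
    suc ∣ T ∣       ≡⟨ extend-size (proj₁ T-max) ⟨
    ∣ T ∪ ⁅ v ⁆ ∣   ≡⟨ maxTwoPacking-size G (extend-maximum T-max) S-max ⟩
    ∣ S ∣           ≡⟨ ∣S∣≡1+k ⟩
    suc k           ∎)
    where open ≡-Reasoning

module _ {n} (G : ExtGraph n) {v u w : Fin n}
  (N[v]≡uw : N G v ≡ ⁅ u ⁆ ∪ ⁅ w ⁆) (deg₂≡0 : deg₂ G v ≡ 0) where

  N²[v]⊆⁅u,v,w⁆ : ∀ {y} → y ∈ N²[ G ] v → y ≡ u ⊎ y ≡ v ⊎ y ≡ w
  N²[v]⊆⁅u,v,w⁆ {y} y∈ with x∈p∪q⁻ (N² G v) _ y∈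
  ... | inj₁ y∈N² = ⊥-elim (∣p∣≡0⇒x∉p deg₂≡0 y∈N²)
  ... | inj₂ y∈N[v] with x∈p∪q⁻ (N G v) ⁅ v ⁆ y∈N[v]
  ...   | inj₂ y∈⁅v⁆ = inj₂ (inj₁ (x∈⁅y⁆⇒x≡y v y∈⁅v⁆))
  ...   | inj₁ y∈N with x∈p∪q⁻ ⁅ u ⁆ ⁅ w ⁆ (subst (y ∈_) N[v]≡uw y∈N)
  ...     | inj₁ y∈⁅u⁆ = inj₁ (x∈⁅y⁆⇒x≡y u y∈⁅u⁆)
  ...     | inj₂ y∈⁅w⁆ = inj₂ (inj₂ (x∈⁅y⁆⇒x≡y w y∈⁅w⁆))

  N²[v]-clique : ∀ {x y} → x ∈ N²[ G ] v → y ∈ N²[ G ] v → x ≢ y → Conflicting G x y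
  N²[v]-clique x∈ y∈ =
    clique₃ (conflicting-sym G) (inj₁ uv∈E) (inj₁ wv∈E) u~w (N²[v]⊆⁅u,v,w⁆ x∈) (N²[v]⊆⁅u,v,w⁆ y∈)
    where
    uv∈E : isE G u v ≡ true
    uv∈E = ∈-tabulate⁻ (subst (u ∈_) (sym N[v]≡uw) (x∈p∪q⁺ (inj₁ (x∈⁅x⁆ u))))

    wv∈E : isE G w v ≡ true
    wv∈E = ∈-tabulate⁻ (subst (w ∈_) (sym N[v]≡uw) (x∈p∪q⁺ (inj₂ (x∈⁅x⁆ w))))

    u~w : u ≢ w → Conflicting G u w
    u~w u≢w with isE-endpoints G uv∈E | isE-endpoints G wv∈E
    ... | u∈V , _ , u~v | w∈V , _ , w~v =
      commonNeighbour⇒conflicting G v u∈V w∈V u≢w u~v (trans (SimpleGraph.sym (host G) v w) w~v)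

mainTheorem8 : ∀ {n} (G : ExtGraph n) (v u w : Fin n) →
    v ∈ V G →
    deg G v ≡ 2 →
    N G v ≡ ⁅ u ⁆ ∪ ⁅ w ⁆ →
    deg G u ≡ 2 →
    deg G w ≡ 2 →
    deg₂ G v ≡ 0 →
    Σ _ (λ S → IsMaxTwoPacking G S × v ∈ S)
    × (∀ (k : ℕ) → IsBeta (induced G (V G ∖ N²[ G ] v)) k → IsBeta G (suc k))
    × (∀ (k : ℕ) → IsBeta G (suc k) → IsBeta (induced G (V G ∖ N²[ G ] v)) k)
mainTheorem8 G v u w v∈V _ N[v]≡uw _ _ deg₂≡0 = v∈maxTwoPacking , β-suc , β-pred
  -- The degree hypotheses are deliberately unused: N²[v] ⊆ {u, v, w} is a clique of the
  -- conflict relation whatever the degrees are.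
  where open SimplicialReduction G v v∈V (N²[v]-clique G N[v]≡uw deg₂≡0)
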